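{- Let $S(n,3)$ be the Sierpiński graph with $n\geq 2$. Then $SSPC_{2U}(S(n,3))\leq 3^{n-1}$.
   Context: The Sierpiński graph $S(n,3)$ has vertex set $\{1,2,3\}^n$ (words $u_1u_2\cdots u_n$), and two words $u\neq v$ are adjacent iff there exists $h\in\{1,\dots,n\}$ such that $u_t=v_t$ for $t<h$, $u_h\neq v_h$, and $u_t=v_h$, $v_t=u_h$ for all $t>h$. For a graph $G$ with distance $d$, a set $S\subseteq V(G)$ is a $2$-strong shortest path union cover if one can choose, for each $u\in S$ and each $v\in V(G)$ with $d(u,v)\leq 2$, a single shortest $u$–$v$ path $P(u,v)$ such that the union of the edge sets of all chosen paths equals $E(G)$; $SSPC_{2U}(G)$ is the minimum cardinality of such a set. -}

module Defs where

open import Data.Nat using (ℕ; zero; suc; _≤_)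
open import Data.Fin using (Fin)
open import Data.Vec using (Vec; []; _∷_)
open import Data.Vec.Relation.Unary.All using (All)
open import Data.List using (List)
open import Data.List.Membership.Propositional using (_∈_)
open import Data.Product using (Σ; ∃; _×_; _,_; proj₁; proj₂)
open import Data.Sum using (_⊎_)
open import Relation.Binary.PropositionalEquality using (_≡_; _≢_)

SV : ℕ → Set
SV n = Vec (Fin 3) n

-- Adjacency in S(n,3): u ~ v iff there is h with u_t = v_t (t < h),
-- u_h ≠ v_h, and u_t = v_h, v_t = u_h for all t > h.
-- Defined by recursion on the common prefix.
data Adj : {n : ℕ} → SV n → SV n → Set where
  same : ∀ {n} {a : Fin 3} {u v : SV n} → Adj u v → Adj (a ∷ u) (a ∷ v)
  diff : ∀ {n} {a b : Fin 3} {u v : SV n} → a ≢ b →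
         All (_≡ b) u → All (_≡ a) v → Adj (a ∷ u) (b ∷ v)

data Walk {n : ℕ} : SV n → SV n → ℕ → Set where
  nil  : ∀ {u} → Walk u u 0
  cons : ∀ {u w v m} → Adj u w → Walk w v m → Walk u v (suc m)

Dist≤ : {n : ℕ} → ℕ → SV n → SV n → Set
Dist≤ k u v = ∃ λ m → m ≤ k × Walk u v m

-- A walk of length m from u to v is a shortest u–v path
-- (i.e. m = d(u,v); such a walk automatically has no repeated vertices).
IsShortest : {n : ℕ} {u v : SV n} {m : ℕ} → Walk u v m → Set
IsShortest {n} {u} {v} {m} _ = ∀ m' → Walk u v m' → m ≤ m'

data EdgeIn {n : ℕ} (x y : SV n) : {u v : SV n} {m : ℕ} → Walk u v m → Set where
  here  : ∀ {v m} (e : Adj x y) (w : Walk y v m) → EdgeIn x y (cons e w)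
  there : ∀ {u w v m} (e : Adj u w) {p : Walk w v m} →
          EdgeIn x y p → EdgeIn x y (cons e p)

-- A choice of paths for S: for each u ∈ S and each v with d(u,v) ≤ 2,
-- one u–v walk P(u,v). The proofs of u ∈ S and d(u,v) ≤ 2 are irrelevant,
-- so exactly one path is chosen per pair (u,v).
PathChoice : {n : ℕ} → List (SV n) → Set
PathChoice {n} S =
  (u v : SV n) → .(u ∈ S) → .(Dist≤ 2 u v) → Σ ℕ (Walk u v)

Is2SSPUCover : {n : ℕ} → List (SV n) → Set
Is2SSPUCover {n} S = Σ (PathChoice S) λ P →
    ((u v : SV n) (h : u ∈ S) (d : Dist≤ 2 u v) → IsShortest (proj₂ (P u v h d)))
  × ((x y : SV n) → Adj x y →
       ∃ λ u → ∃ λ v → Σ (u ∈ S) λ h → Σ (Dist≤ 2 u v) λ d →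
         EdgeIn x y (proj₂ (P u v h d)) ⊎ EdgeIn y x (proj₂ (P u v h d)))

{-# OPTIONS --safe #-}
-- Take S to be the 3^(n-1) words whose last two letters are a, a+1 (mod 3).
-- S(n,3) has no 4-cycles, so two vertices at distance 2 have a unique common
-- neighbour and the chosen shortest u–y path traverses the edge x → y as soon
-- as u = x, or u is adjacent to x and at distance 2 from y.  Every edge has an
-- orientation x → y reached in this way from some u ∈ S: for n = 2 by
-- inspection, for an edge inside a copy a S(n-1,3) by induction, and for the
-- bridge edge i j…j — j i…i through u = i j…j (j+1).
module Submission where

open import Defs
open import Data.Nat using (ℕ; zero; suc; _+_; _*_; _≤_; _^_; _∸_; z≤n; s≤s)
open import Data.Nat.Properties using (≤-refl; ≤-reflexive)
open import Data.Fin using (Fin; zero; suc)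
open import Data.Fin.Properties using (_≟_; any?; all?)
open import Data.Vec using ([]; _∷_; replicate)
open import Data.Vec.Properties using (≡-dec; ∷-injective; ∷-injectiveˡ)
open import Data.Vec.Relation.Unary.All using (All; []; _∷_)
import Data.Vec.Relation.Unary.All as All
import Data.List.Relation.Unary.All as ListAll
open import Data.List using (List; []; _∷_; length; map; _++_; cartesianProductWith; allFin)
open import Data.List.Properties using (length-map; length-++)
open import Data.List.Membership.Propositional using (_∈_)
open import Data.List.Membership.Propositional.Properties
  using (∈-map⁺; ∈-allFin; ∈-cartesianProductWith⁺)
open import Data.List.Relation.Unary.Any using (here)
open import Data.List.Relation.Unary.Unique.Propositional using (Unique; []; _∷_)
open import Data.List.Relation.Unary.Unique.Propositional.Properties
  using (map⁺; allFin⁺; cartesianProductWith⁺)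
open import Data.Product using (Σ; ∃; _×_; _,_; proj₁; proj₂)
open import Data.Sum using (_⊎_; inj₁; inj₂; [_,_]′)
import Data.Sum as Sum
open import Data.Empty using (⊥-elim)
import Data.Empty.Irrelevant as Irrelevant
open import Relation.Nullary using (¬_; Dec; yes; no)
open import Relation.Nullary.Decidable using (map′; _×-dec_; _⊎-dec_; _→-dec_; ¬?; from-yes)
open import Relation.Unary using (Decidable)
open import Relation.Binary.PropositionalEquality using (_≡_; _≢_; refl; sym; cong; cong₂; subst; module ≡-Reasoning)
open ≡-Reasoning

words : (n : ℕ) → List (SV n)
words zero    = [] ∷ []
words (suc n) = cartesianProductWith _∷_ (allFin 3) (words n)

∈-words : ∀ {n} (v : SV n) → v ∈ words n
∈-words []      = here refl
∈-words (a ∷ v) = ∈-cartesianProductWith⁺ _∷_ (∈-allFin a) (∈-words v)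

words-unique : ∀ n → Unique (words n)
words-unique zero    = ListAll.[] ∷ []
words-unique (suc n) = cartesianProductWith⁺ _∷_ ∷-injective (allFin⁺ 3) (words-unique n)

length-cartesianProductWith : ∀ {A B C : Set} (f : A → B → C) (xs : List A) (ys : List B) →
  length (cartesianProductWith f xs ys) ≡ length xs * length ys
length-cartesianProductWith f []       ys = refl
length-cartesianProductWith f (x ∷ xs) ys = begin
  length (map (f x) ys ++ cartesianProductWith f xs ys)
    ≡⟨ length-++ (map (f x) ys) ⟩
  length (map (f x) ys) + length (cartesianProductWith f xs ys)
    ≡⟨ cong₂ _+_ (length-map (f x) ys) (length-cartesianProductWith f xs ys) ⟩
  length ys + length xs * length ys ∎

length-words : ∀ n → length (words n) ≡ 3 ^ n
length-words zero    = refl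
length-words (suc n) = begin
  length (words (suc n))             ≡⟨ length-cartesianProductWith _∷_ (allFin 3) (words n) ⟩
  3 * length (words n)               ≡⟨ cong (3 *_) (length-words n) ⟩
  3 ^ suc n                          ∎

∃-word? : ∀ {n} {P : SV n → Set} → Decidable P → Dec (∃ P)
∃-word? {zero}  P? = map′ ([] ,_) (λ { ([] , p) → p }) (P? [])
∃-word? {suc n} P? =
  map′ (λ (a , v , p) → a ∷ v , p) (λ { (a ∷ v , p) → a , v , p })
       (any? λ a → ∃-word? λ v → P? (a ∷ v))

∀-word? : ∀ {n} {P : SV n → Set} → Decidable P → Dec (∀ v → P v)
∀-word? {zero}  P? = map′ (λ { p [] → p }) (λ p → p []) (P? [])
∀-word? {suc n} P? =
  map′ (λ p → λ { (a ∷ v) → p a v }) (λ p a v → p (a ∷ v))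
       (all? λ a → ∀-word? λ v → P? (a ∷ v))

adj? : ∀ {n} (u v : SV n) → Dec (Adj u v)
adj? [] [] = no λ ()
adj? (a ∷ u) (b ∷ v) with a ≟ b
... | yes refl = map′ same (λ { (same e) → e ; (diff a≢a _ _) → ⊥-elim (a≢a refl) }) (adj? u v)
... | no a≢b   = map′ (λ (p , q) → diff a≢b p q)
                      (λ { (same _) → ⊥-elim (a≢b refl) ; (diff _ p q) → p , q })
                      (All.all? (_≟ b) u ×-dec All.all? (_≟ a) v)

adj-irrefl : ∀ {n} {x : SV n} → ¬ Adj x x
adj-irrefl (same e)        = adj-irrefl e
adj-irrefl (diff a≢a _ _) = a≢a refl

adj-sym : ∀ {n} {x y : SV n} → Adj x y → Adj y x
adj-sym (same e)       = same (adj-sym e)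
adj-sym (diff a≢b p q) = diff (λ b≡a → a≢b (sym b≡a)) q p

CommonNeighbour : ∀ {n} → SV n → SV n → Set
CommonNeighbour {n} u v = Σ (SV n) λ w → Adj u w × Adj w v

common-neighbour? : ∀ {n} (u v : SV n) → Dec (CommonNeighbour u v)
common-neighbour? u v = ∃-word? λ w → adj? u w ×-dec adj? w v

constant-≡ : ∀ {n} {c : Fin 3} {X Y : SV n} → All (_≡ c) X → All (_≡ c) Y → X ≡ Y
constant-≡ []         []         = refl
constant-≡ (refl ∷ p) (refl ∷ q) = cong (_ ∷_) (constant-≡ p q)

-- The middle word would be constantly a and constantly c, so a ≡ c or n ≡ 0.
bridge-bridge : ∀ {n} {a b c : Fin 3} {U W V : SV n} →
  All (_≡ b) U → All (_≡ a) W → All (_≡ c) W → All (_≡ b) V →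
  a ∷ U ≡ c ∷ V ⊎ Adj (a ∷ U) (c ∷ V)
bridge-bridge {a = a} {c = c} U≡b _ _ V≡b with a ≟ c
... | yes refl = inj₁ (cong (a ∷_) (constant-≡ U≡b V≡b))
bridge-bridge [] [] [] [] | no a≢c = inj₂ (diff a≢c [] [])
bridge-bridge _ (refl ∷ _) (a≡c ∷ _) _ | no a≢c = ⊥-elim (a≢c a≡c)

common-neighbour-unique : ∀ {n} {u w₁ w₂ v : SV n} →
  u ≢ v → ¬ Adj u v → Adj u w₁ → Adj w₁ v → Adj u w₂ → Adj w₂ v → w₁ ≡ w₂
common-neighbour-unique u≢v ¬uv (same e₁) (same e₂) (same e₃) (same e₄) =
  cong (_ ∷_) (common-neighbour-unique (λ eq → u≢v (cong (_ ∷_) eq)) (λ e → ¬uv (same e)) e₁ e₂ e₃ e₄)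
common-neighbour-unique u≢v ¬uv (diff _ U≡b W≡a) (diff _ W≡c V≡b) _ _ =
  ⊥-elim ([ u≢v , ¬uv ]′ (bridge-bridge U≡b W≡a W≡c V≡b))
common-neighbour-unique u≢v ¬uv _ _ (diff _ U≡b W≡a) (diff _ W≡c V≡b) =
  ⊥-elim ([ u≢v , ¬uv ]′ (bridge-bridge U≡b W≡a W≡c V≡b))
common-neighbour-unique _ _ (same _) (same _) (same _) (diff a≢a _ _) = ⊥-elim (a≢a refl)
common-neighbour-unique _ _ (same _) (same _) (diff a≢a _ _) (same _) = ⊥-elim (a≢a refl)
common-neighbour-unique _ _ (same _) (diff a≢a _ _) (same _) (same _) = ⊥-elim (a≢a refl)
common-neighbour-unique _ _ (diff a≢a _ _) (same _) (same _) (same _) = ⊥-elim (a≢a refl)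
common-neighbour-unique _ _ (same _) (diff _ W₁≡c _) (same _) (diff _ W₂≡c _) =
  cong (_ ∷_) (constant-≡ W₁≡c W₂≡c)
common-neighbour-unique _ _ (diff _ _ W₁≡a) (same _) (diff _ _ W₂≡a) (same _) =
  cong (_ ∷_) (constant-≡ W₁≡a W₂≡a)
common-neighbour-unique _ _ (same _) (diff _ _ V≡a) (diff _ _ W₂≡a) (same e) =
  ⊥-elim (adj-irrefl (subst (λ z → Adj z _) (constant-≡ W₂≡a V≡a) e))
common-neighbour-unique _ _ (diff _ _ W₁≡a) (same e) (same _) (diff _ _ V≡a) =
  ⊥-elim (adj-irrefl (subst (λ z → Adj z _) (constant-≡ W₁≡a V≡a) e))

Geodesic : ∀ {n} → SV n → SV n → Set
Geodesic u v = Σ (Σ ℕ (Walk u v)) λ p → IsShortest (proj₂ p)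

walk-length≥1 : ∀ {n} {u v : SV n} {m} → u ≢ v → Walk u v m → 1 ≤ m
walk-length≥1 u≢u nil        = ⊥-elim (u≢u refl)
walk-length≥1 _   (cons _ _) = s≤s z≤n

walk-length≥2 : ∀ {n} {u v : SV n} {m} → u ≢ v → ¬ Adj u v → Walk u v m → 2 ≤ m
walk-length≥2 u≢u _   nil                 = ⊥-elim (u≢u refl)
walk-length≥2 _   ¬uv (cons e nil)        = ⊥-elim (¬uv e)
walk-length≥2 _   _   (cons _ (cons _ _)) = s≤s (s≤s z≤n)

dist≤2-cases : ∀ {n} {u v : SV n} → Dist≤ 2 u v → u ≡ v ⊎ Adj u v ⊎ CommonNeighbour u v
dist≤2-cases (_ , _ , nil)                 = inj₁ refl
dist≤2-cases (_ , _ , cons e nil)          = inj₂ (inj₁ e)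
dist≤2-cases (_ , _ , cons e (cons e′ nil)) = inj₂ (inj₂ (_ , e , e′))
dist≤2-cases (_ , s≤s (s≤s ()) , cons _ (cons _ (cons _ _)))

geodesic : ∀ {n} (u v : SV n) → .(Dist≤ 2 u v) → Geodesic u v
geodesic u v d with ≡-dec _≟_ u v | adj? u v | common-neighbour? u v
... | yes refl | _        | _                    = (0 , nil) , λ _ _ → z≤n
... | no u≢v   | yes e    | _                    = (1 , cons e nil) , λ _ → walk-length≥1 u≢v
... | no u≢v   | no ¬uv   | yes (_ , e₁ , e₂)    = (2 , cons e₁ (cons e₂ nil)) , λ _ → walk-length≥2 u≢v ¬uv
... | no u≢v   | no ¬uv   | no ¬w                =
  Irrelevant.⊥-elim ([ u≢v , [ ¬uv , ¬w ]′ ]′ (dist≤2-cases d))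

path : ∀ {n} (u v : SV n) → .(Dist≤ 2 u v) → Σ ℕ (Walk u v)
path u v d = proj₁ (geodesic u v d)

path-adj : ∀ {n} {u v : SV n} .{d : Dist≤ 2 u v} → Adj u v → EdgeIn u v (proj₂ (path u v d))
path-adj {u = u} {v} e with ≡-dec _≟_ u v | adj? u v | common-neighbour? u v
... | yes refl | _      | _ = ⊥-elim (adj-irrefl e)
... | no _     | yes e′ | _ = here e′ nil
... | no _     | no ¬uv | _ = ⊥-elim (¬uv e)

path-via : ∀ {n} {u x v : SV n} .{d : Dist≤ 2 u v} → u ≢ v → ¬ Adj u v →
  Adj u x → Adj x v → EdgeIn x v (proj₂ (path u v d))
path-via {u = u} {x} {v} u≢v ¬uv ux xv with ≡-dec _≟_ u v | adj? u v | common-neighbour? u v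
... | yes u≡v | _      | _                 = ⊥-elim (u≢v u≡v)
... | no _    | yes uv | _                 = ⊥-elim (¬uv uv)
... | no _    | no _   | no ¬w             = ⊥-elim (¬w (x , ux , xv))
... | no _    | no _   | yes (_ , e₁ , e₂) with common-neighbour-unique u≢v ¬uv e₁ e₂ ux xv
...   | refl = there e₁ (here e₂ nil)

next : Fin 3 → Fin 3
next zero             = suc zero
next (suc zero)       = suc (suc zero)
next (suc (suc zero)) = zero

next-≢ : ∀ a → next a ≢ a
next-≢ zero             ()
next-≢ (suc zero)       ()
next-≢ (suc (suc zero)) ()

extend : ∀ {m} → SV (suc m) → SV (suc (suc m))
extend {zero}  (a ∷ []) = a ∷ next a ∷ []
extend {suc m} (a ∷ w)  = a ∷ extend w

extend-injective : ∀ {m} {v w : SV (suc m)} → extend v ≡ extend w → v ≡ w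
extend-injective {zero}  {_ ∷ []} {_ ∷ []} refl = refl
extend-injective {suc m} {a ∷ v}  {b ∷ w}  eq with ∷-injective eq
... | refl , ev≡ew = cong (a ∷_) (extend-injective ev≡ew)

cover : ∀ k → List (SV (suc (suc k)))
cover k = map extend (words (suc k))

∈-cover : ∀ {k} (w : SV (suc k)) → extend w ∈ cover k
∈-cover w = ∈-map⁺ extend (∈-words w)

cover-unique : ∀ k → Unique (cover k)
cover-unique k = map⁺ extend-injective (words-unique (suc k))

length-cover : ∀ k → length (cover k) ≡ 3 ^ suc k
length-cover k = begin
  length (map extend (words (suc k))) ≡⟨ length-map extend (words (suc k)) ⟩
  length (words (suc k))              ≡⟨ length-words (suc k) ⟩
  3 ^ suc k                           ∎

extend-replicate-adj : ∀ {m} {j : Fin 3} {xs : SV (suc (suc m))} →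
  All (_≡ j) xs → Adj (extend (replicate (suc m) j)) xs
extend-replicate-adj {zero}  {j} (refl ∷ refl ∷ []) = same (diff (next-≢ j) [] [])
extend-replicate-adj {suc m}     (refl ∷ xs≡j)      = same (extend-replicate-adj xs≡j)

extend-replicate-nonconstant : ∀ {m} {j : Fin 3} → ¬ All (_≡ j) (extend (replicate (suc m) j))
extend-replicate-nonconstant {zero}  {j} (_ ∷ next-j≡j ∷ []) = next-≢ j next-j≡j
extend-replicate-nonconstant {suc m}     (_ ∷ p)             = extend-replicate-nonconstant p

-- For an edge x → y this makes it the last edge of a shortest u–y path.
Approach : ∀ {n} → SV n → SV n → SV n → Set
Approach u x y = u ≡ x ⊎ (Adj u x × u ≢ y × ¬ Adj u y)

Approached : ∀ {m} → SV (suc (suc m)) → SV (suc (suc m)) → Set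
Approached {m} x y = Σ (SV (suc m)) λ w → Approach (extend w) x y

approach? : ∀ {n} (u x y : SV n) → Dec (Approach u x y)
approach? u x y =
  ≡-dec _≟_ u x ⊎-dec (adj? u x ×-dec ¬? (≡-dec _≟_ u y) ×-dec ¬? (adj? u y))

approach-∷ : ∀ {n} {a : Fin 3} {u x y : SV n} → Approach u x y → Approach (a ∷ u) (a ∷ x) (a ∷ y)
approach-∷ (inj₁ refl)               = inj₁ refl
approach-∷ (inj₂ (ux , u≢y , ¬uy)) =
  inj₂ ( same ux
       , (λ eq → u≢y (proj₂ (∷-injective eq)))
       , λ { (same uy) → ¬uy uy ; (diff a≢a _ _) → a≢a refl })

edge-approached-S₂ : (x y : SV 2) → Adj x y → Approached x y ⊎ Approached y x
edge-approached-S₂ = from-yes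
  (∀-word? λ x → ∀-word? λ y → adj? x y →-dec (approached? x y ⊎-dec approached? y x))
  where
  approached? : (x y : SV 2) → Dec (Approached x y)
  approached? x y = ∃-word? λ w → approach? (extend w) x y

edge-approached : ∀ k {x y : SV (suc (suc k))} → Adj x y → Approached x y ⊎ Approached y x
edge-approached zero             e        = edge-approached-S₂ _ _ e
edge-approached (suc k)          (same e) =
  Sum.map (λ (w , a) → _ ∷ w , approach-∷ a) (λ (w , a) → _ ∷ w , approach-∷ a) (edge-approached k e)
edge-approached (suc k) {i ∷ xs} (diff i≢j xs≡j _) =
  inj₁ ( i ∷ replicate (suc k) _
       , inj₂ ( same (extend-replicate-adj xs≡j)
              , (λ eq → i≢j (∷-injectiveˡ eq))
              , λ { (same _) → i≢j refl ; (diff _ p _) → extend-replicate-nonconstant p }))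

approach-traverses : ∀ {n} {u x y : SV n} → Approach u x y → Adj x y →
  Σ (Dist≤ 2 u y) λ d → EdgeIn x y (proj₂ (path u y d))
approach-traverses (inj₁ refl)              xy = (1 , s≤s z≤n , cons xy nil) , path-adj xy
approach-traverses (inj₂ (ux , u≢y , ¬uy)) xy =
  (2 , ≤-refl , cons ux (cons xy nil)) , path-via u≢y ¬uy ux xy

mainTheorem15 : (n : ℕ) → 2 ≤ n →
    Σ (List (SV n)) λ S → Unique S × length S ≤ 3 ^ (n ∸ 1) × Is2SSPUCover S
mainTheorem15 (suc zero)    (s≤s ())
mainTheorem15 (suc (suc k)) _ =
  cover k , cover-unique k , ≤-reflexive (length-cover k) ,
  (λ u v _ d → path u v d) , (λ u v _ d → proj₂ (geodesic u v d)) , covered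
  where
  covered : (x y : SV (suc (suc k))) → Adj x y →
    ∃ λ u → ∃ λ v → Σ (u ∈ cover k) λ _ → Σ (Dist≤ 2 u v) λ d →
      EdgeIn x y (proj₂ (path u v d)) ⊎ EdgeIn y x (proj₂ (path u v d))
  covered x y xy with edge-approached k xy
  ... | inj₁ (w , a) = let d , t = approach-traverses a xy in extend w , y , ∈-cover w , d , inj₁ t
  ... | inj₂ (w , a) = let d , t = approach-traverses a (adj-sym xy) in extend w , x , ∈-cover w , d , inj₂ t
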